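{- Let $m\ge0$ and $k\ge2$ be integers. Let $R^{(m)}_{\mathrm{cop}}(k;2)$ be the least $n\ge1$ such that every coloring of $\{m+1,\ldots,m+n\}$ with two colors has a color class containing $k$ pairwise coprime integers. With the convention $\pi(0)=0$, where $\pi$ is the prime-counting function, \[ R^{(m)}_{\mathrm{cop}}(k;2)\le \min\{n:\pi(m+n)-\pi(m)\ge 2k-1\}\le p_{\pi(m)+2k-1}-m, \] where $p_j$ is the $j$-th prime ($p_1=2$).
   Context: A set of pairwise coprime integers means a set of distinct positive integers any two of which have greatest common divisor $1$. -}

module Defs where

open import Data.Nat using (ℕ; suc; _+_; _≤_)
open import Data.Nat.Primality using (Prime; prime?)
open import Data.Nat.Coprimality using (Coprime)
open import Data.Bool using (Bool)
open import Data.List using (List; length; filter; upTo)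
open import Data.List.Relation.Unary.All using (All)
open import Data.List.Relation.Unary.AllPairs using (AllPairs)
open import Data.List.Relation.Unary.Unique.Propositional using (Unique)
open import Data.Product using (_×_; ∃)
open import Relation.Binary.PropositionalEquality using (_≡_)

primeCount : ℕ → ℕ
primeCount n = length (filter prime? (upTo (suc n)))

IsNthPrime : ℕ → ℕ → Set
IsNthPrime j p = Prime p × primeCount p ≡ j

IsLeast : (ℕ → Set) → ℕ → Set
IsLeast P n = P n × (∀ n' → P n' → n ≤ n')

-- Every 2-coloring of {m+1,…,m+n} has a color class containing k
-- pairwise coprime (distinct) integers.  A coloring is a function ℕ → Bool;
-- only its values on {m+1,…,m+n} are relevant.
CopRamseyProperty : ℕ → ℕ → ℕ → Set
CopRamseyProperty m k n =
  (c : ℕ → Bool) →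
  ∃ λ (b : Bool) → ∃ λ (xs : List ℕ) →
    length xs ≡ k × Unique xs × AllPairs Coprime xs ×
    All (λ x → suc m ≤ x × x ≤ m + n × c x ≡ b) xs

IsCopRamseyNumber : ℕ → ℕ → ℕ → Set
IsCopRamseyNumber m k = IsLeast (λ n → 1 ≤ n × CopRamseyProperty m k n)

{-# OPTIONS --safe #-}
-- The primes in {m+1,…,m+n} are pairwise coprime and there are π(m+n) − π(m) of them, so as soon
-- as there are 2k − 1 of them one color class contains k of them by pigeonhole; hence R ≤ N.
-- Moreover {m+1,…,p} contains 2k − 1 primes when p is the (π(m)+2k−1)-th prime, so N ≤ p − m.
-- Both least elements exist constructively: N because there are infinitely many primes (Euclid),
-- R because the Ramsey property is decidable, as only the colors of 0,…,m+n matter.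
module Submission where

open import Defs
open import Data.Bool using (Bool; true; false)
import Data.Bool as Bool
open import Data.List using (List; []; _∷_; [_]; _++_; length; filter; take; upTo; applyDownFrom)
open import Data.List.Properties using (upTo-∷ʳ; filter-++; filter-accept; length-++; length-take)
open import Data.List.Relation.Unary.All as All using (All; []; _∷_)
import Data.List.Relation.Unary.All.Properties as Allₚ
open import Data.List.Relation.Unary.AllPairs as AllPairs using (AllPairs; []; _∷_; allPairs?)
import Data.List.Relation.Unary.AllPairs.Properties as AllPairsₚ
open import Data.List.Relation.Unary.Unique.Propositional using (Unique)
open import Data.Nat
  using (ℕ; zero; suc; _+_; _*_; _∸_; _!; _≤_; _<_; _>_; _≰_; _≤?_; _≟_; z≤n; s≤s; z<s; NonZero; nonTrivial⇒≢1)
open import Data.List.Relation.Unary.Unique.DecPropositional _≟_ using (unique?)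
open import Data.Nat.Properties
open import Data.Nat.Divisibility using (_∣_; m∣m*n; ∣-trans; ∣m+n∣m⇒∣n; ∣1⇒≡1; m≤n⇒m!∣n!)
open import Data.Nat.Induction using (<-rec)
open import Data.Nat.ListAction using (product)
open import Data.Nat.Primality using (Prime; prime?; prime⇒nonZero; prime⇒nonTrivial)
open import Data.Nat.Primality.Factorisation using (factorise)
open import Data.Nat.Coprimality using (Coprime; coprime?; prime⇒coprime)
open import Data.Product using (_×_; _,_; proj₁; proj₂; ∃)
open import Data.Sum using (_⊎_; inj₁; inj₂; [_,_])
open import Function using (_∘_)
open import Relation.Nullary using (Dec; yes; no; contradiction)
open import Relation.Nullary.Decidable as Dec using (_×-dec_; _⊎-dec_)
open import Relation.Unary using (Decidable)
open import Relation.Binary.PropositionalEquality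
  using (_≡_; refl; sym; trans; cong; subst; module ≡-Reasoning)

interval : ℕ → ℕ → List ℕ
interval m = applyDownFrom (λ i → suc (m + i))

primesIn : ℕ → ℕ → List ℕ
primesIn m n = filter prime? (interval m n)

primeCount-suc : ∀ n → primeCount (suc n) ≡ primeCount n + length (filter prime? [ suc n ])
primeCount-suc n = begin
  length (filter prime? (upTo (suc (suc n))))
    ≡⟨ cong (length ∘ filter prime?) (upTo-∷ʳ (suc n)) ⟨
  length (filter prime? (upTo (suc n) ++ [ suc n ]))
    ≡⟨ cong length (filter-++ prime? (upTo (suc n)) [ suc n ]) ⟩
  length (filter prime? (upTo (suc n)) ++ filter prime? [ suc n ])
    ≡⟨ length-++ (filter prime? (upTo (suc n))) ⟩
  primeCount n + length (filter prime? [ suc n ]) ∎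
  where open ≡-Reasoning

primeCount-+ : ∀ m n → primeCount (m + n) ≡ primeCount m + length (primesIn m n)
primeCount-+ m zero = trans (cong primeCount (+-identityʳ m)) (sym (+-identityʳ _))
primeCount-+ m (suc n) = begin
  primeCount (m + suc n)                 ≡⟨ cong primeCount (+-suc m n) ⟩
  primeCount (suc (m + n))               ≡⟨ primeCount-suc (m + n) ⟩
  primeCount (m + n) + new               ≡⟨ cong (_+ new) (primeCount-+ m n) ⟩
  primeCount m + length (primesIn m n) + new
    ≡⟨ +-assoc (primeCount m) _ new ⟩
  primeCount m + (length (primesIn m n) + new)
    ≡⟨ cong (primeCount m +_) (+-comm _ new) ⟩
  primeCount m + (new + length (primesIn m n))
    ≡⟨ cong (primeCount m +_) (trans (cong length (filter-++ prime? [ suc (m + n) ] _))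
                                     (length-++ (filter prime? [ suc (m + n) ]))) ⟨
  primeCount m + length (primesIn m (suc n)) ∎
  where
  open ≡-Reasoning
  new = length (filter prime? [ suc (m + n) ])

length-primesIn : ∀ m n → length (primesIn m n) ≡ primeCount (m + n) ∸ primeCount m
length-primesIn m n = sym (trans (cong (_∸ primeCount m) (primeCount-+ m n)) (m+n∸m≡n (primeCount m) _))

primeCount-mono-≤ : ∀ {m n} → m ≤ n → primeCount m ≤ primeCount n
primeCount-mono-≤ {m} {n} m≤n = begin
  primeCount m                                    ≤⟨ m≤m+n _ _ ⟩
  primeCount m + length (primesIn m (n ∸ m))      ≡⟨ primeCount-+ m (n ∸ m) ⟨
  primeCount (m + (n ∸ m))                        ≡⟨ cong primeCount (m+[n∸m]≡n m≤n) ⟩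
  primeCount n                                    ∎
  where open ≤-Reasoning

primeCount-<-prime : ∀ {n p} → Prime p → n < p → primeCount n < primeCount p
primeCount-<-prime {n} {suc q} p-prime (s≤s n≤q) = begin-strict
  primeCount n                                    ≤⟨ primeCount-mono-≤ n≤q ⟩
  primeCount q                                    <⟨ m<m+n (primeCount q) z<s ⟩
  primeCount q + 1
    ≡⟨ cong (λ ps → primeCount q + length ps) (filter-accept prime? p-prime) ⟨
  primeCount q + length (filter prime? [ suc q ]) ≡⟨ primeCount-suc q ⟨
  primeCount (suc q)                              ∎
  where open ≤-Reasoning

prime∣ : ∀ {n} → 1 < n → ∃ λ p → Prime p × p ∣ n
prime∣ {n@(suc _)} 1<n with factorise n
... | record { factors = [] ; isFactorisation = n≡1 } = contradiction n≡1 (>⇒≢ 1<n)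
... | record { factors = p ∷ ps ; isFactorisation = n≡p*ps ; factorsPrime = p-prime ∷ _ } =
  p , p-prime , subst (p ∣_) (sym n≡p*ps) (m∣m*n (product ps))

n∣n! : ∀ n → .{{NonZero n}} → n ∣ n !
n∣n! (suc n) = m∣m*n (n !)

prime> : ∀ n → ∃ λ p → n < p × Prime p
prime> n with prime∣ {suc (n !)} (s≤s (1≤n! n))
... | p , p-prime , p∣1+n! = p , ≰⇒> p≰n , p-prime
  where
  p≰n : p ≰ n
  p≰n p≤n = nonTrivial⇒≢1 {{prime⇒nonTrivial p-prime}} (∣1⇒≡1 (∣m+n∣m⇒∣n
    (subst (p ∣_) (+-comm 1 (n !)) p∣1+n!)
    (∣-trans (n∣n! p {{prime⇒nonZero p-prime}}) (m≤n⇒m!∣n! p≤n))))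

primeCount-unbounded : ∀ j → ∃ λ n → j ≤ primeCount n
primeCount-unbounded zero = 0 , z≤n
primeCount-unbounded (suc j) with primeCount-unbounded j
... | n , j≤πn with prime> n
... | p , n<p , p-prime = p , ≤-<-trans j≤πn (primeCount-<-prime p-prime n<p)

AtLeastPrimesIn : ℕ → ℕ → ℕ → Set
AtLeastPrimesIn d m n = d ≤ primeCount (m + n) ∸ primeCount m

atLeastPrimesIn-unbounded : ∀ d m → ∃ (AtLeastPrimesIn d m)
atLeastPrimesIn-unbounded d m with primeCount-unbounded (primeCount m + d)
... | n , πm+d≤πn = n , (begin
  d                                   ≡⟨ m+n∸m≡n (primeCount m) d ⟨
  primeCount m + d ∸ primeCount m     ≤⟨ ∸-monoˡ-≤ (primeCount m) πm+d≤πn ⟩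
  primeCount n ∸ primeCount m         ≤⟨ ∸-monoˡ-≤ (primeCount m) (primeCount-mono-≤ (m≤n+m n m)) ⟩
  primeCount (m + n) ∸ primeCount m   ∎)
  where open ≤-Reasoning

atLeastPrimesIn-positive : ∀ {d} m {n} → 1 ≤ d → AtLeastPrimesIn d m n → 1 ≤ n
atLeastPrimesIn-positive m {suc _} _ _ = s≤s z≤n
atLeastPrimesIn-positive {d} m {zero} 1≤d enough = contradiction (≤-trans 1≤d (begin
  d                                   ≤⟨ enough ⟩
  primeCount (m + 0) ∸ primeCount m   ≡⟨ cong (λ x → primeCount x ∸ primeCount m) (+-identityʳ m) ⟩
  primeCount m ∸ primeCount m         ≡⟨ n∸n≡0 (primeCount m) ⟩
  0                                   ∎)) λ ()
  where open ≤-Reasoning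

nthPrime⇒atLeastPrimesIn : ∀ {d} m {p} → IsNthPrime (primeCount m + d) p → AtLeastPrimesIn d m (p ∸ m)
nthPrime⇒atLeastPrimesIn {d} m {p} (_ , πp≡πm+d) = begin
  d                                   ≡⟨ m+n∸m≡n (primeCount m) d ⟨
  primeCount m + d ∸ primeCount m     ≡⟨ cong (_∸ primeCount m) πp≡πm+d ⟨
  primeCount p ∸ primeCount m         ≤⟨ ∸-monoˡ-≤ (primeCount m) (primeCount-mono-≤ (m≤n+m∸n p m)) ⟩
  primeCount (m + (p ∸ m)) ∸ primeCount m ∎
  where open ≤-Reasoning

applyDownFrom⁺ : ∀ {A : Set} {P : A → Set} f n → (∀ {i} → i < n → P (f i)) → All P (applyDownFrom f n)
applyDownFrom⁺ f zero    Pf = []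
applyDownFrom⁺ f (suc n) Pf = Pf ≤-refl ∷ applyDownFrom⁺ f n (Pf ∘ m<n⇒m<1+n)

applyDownFrom-descending : ∀ {f} → (∀ {i j} → i < j → f i < f j) → ∀ n → AllPairs _>_ (applyDownFrom f n)
applyDownFrom-descending         f-mono zero    = []
applyDownFrom-descending {f = f} f-mono (suc n) =
  applyDownFrom⁺ f n f-mono ∷ applyDownFrom-descending f-mono n

primesIn-descending : ∀ m n → AllPairs _>_ (primesIn m n)
primesIn-descending m n = AllPairsₚ.filter⁺ prime? (applyDownFrom-descending (s≤s ∘ +-monoʳ-< m) n)

primesIn-bounds : ∀ m n → All (λ p → Prime p × suc m ≤ p × p ≤ m + n) (primesIn m n)
primesIn-bounds m n = All.zip
  ( Allₚ.all-filter prime? (interval m n)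
  , Allₚ.filter⁺ prime? (applyDownFrom⁺ (λ i → suc (m + i)) n
                          (λ i<n → s≤s (m≤m+n m _) , +-monoʳ-< m i<n)))

descendingPrimes⇒coprime : ∀ {ps} → All Prime ps → AllPairs _>_ ps → AllPairs Coprime ps
descendingPrimes⇒coprime []                 []             = []
descendingPrimes⇒coprime (p-prime ∷ primes) (p>ps ∷ desc) =
  All.zipWith (λ (q-prime , q<p) {d} → prime⇒coprime p-prime {{prime⇒nonZero q-prime}} q<p {d})
              (primes , p>ps)
  ∷ descendingPrimes⇒coprime primes desc

pigeonhole₂ : ∀ {a b} k → 2 * k ∸ 1 ≤ a + b → k ≤ a ⊎ k ≤ b
pigeonhole₂ {a} {b} k 2k∸1≤a+b with k ≤? a | k ≤? b
... | yes k≤a | _       = inj₁ k≤a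
... | no _    | yes k≤b = inj₂ k≤b
... | no k≰a  | no k≰b  = contradiction 2k∸1≤a+b (<⇒≱ (∸-monoˡ-≤ 1 (begin
  suc (suc (a + b)) ≡⟨ cong suc (+-suc a b) ⟨
  suc a + suc b     ≤⟨ +-mono-≤ (≰⇒> k≰a) (≰⇒> k≰b) ⟩
  k + k             ≡⟨ cong (k +_) (+-identityʳ k) ⟨
  2 * k             ∎)))
  where open ≤-Reasoning

colorClass : (ℕ → Bool) → Bool → List ℕ → List ℕ
colorClass c b = filter (λ x → c x Bool.≟ b)

length-colorClasses : ∀ c xs →
  length (colorClass c true xs) + length (colorClass c false xs) ≡ length xs
length-colorClasses c [] = refl
length-colorClasses c (x ∷ xs) with c x
... | true  = cong suc (length-colorClasses c xs)
... | false = trans (+-suc _ _) (cong suc (length-colorClasses c xs))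

monochromatic : ∀ c xs k → 2 * k ∸ 1 ≤ length xs → ∃ λ b → k ≤ length (colorClass c b xs)
monochromatic c xs k 2k∸1≤
  with pigeonhole₂ k (subst (2 * k ∸ 1 ≤_) (sym (length-colorClasses c xs)) 2k∸1≤)
... | inj₁ k≤ = true , k≤
... | inj₂ k≤ = false , k≤

-- CopRamseyProperty m k n unfolds to ∀ c → ∃ (MonochromaticCoprime m k n c).
MonochromaticCoprime : ℕ → ℕ → ℕ → (ℕ → Bool) → Bool → Set
MonochromaticCoprime m k n c b = ∃ λ (xs : List ℕ) →
  length xs ≡ k × Unique xs × AllPairs Coprime xs ×
  All (λ x → suc m ≤ x × x ≤ m + n × c x ≡ b) xs

descendingPrimes⇒monochromaticCoprime : ∀ {m n c b ps} k → k ≤ length ps →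
  AllPairs _>_ ps → All (λ p → Prime p × suc m ≤ p × p ≤ m + n) ps → All (λ p → c p ≡ b) ps →
  MonochromaticCoprime m k n c b
descendingPrimes⇒monochromaticCoprime {m} {n} {ps = ps} k k≤|ps| desc bounds colored =
  take k ps ,
  trans (length-take k ps) (m≤n⇒m⊓n≡m k≤|ps|) ,
  AllPairs.map >⇒≢ desc′ ,
  descendingPrimes⇒coprime (All.map proj₁ bounds′) desc′ ,
  All.zipWith (λ ((_ , lo , hi) , cp≡b) → lo , hi , cp≡b) (bounds′ , Allₚ.take⁺ k colored)
  where
  desc′ : AllPairs _>_ (take k ps)
  desc′ = AllPairsₚ.take⁺ k desc
  bounds′ : All (λ p → Prime p × suc m ≤ p × p ≤ m + n) (take k ps)
  bounds′ = Allₚ.take⁺ k bounds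

primes⇒copRamsey : ∀ m k n → AtLeastPrimesIn (2 * k ∸ 1) m n → CopRamseyProperty m k n
primes⇒copRamsey m k n enough c
  with monochromatic c (primesIn m n) k (subst (2 * k ∸ 1 ≤_) (sym (length-primesIn m n)) enough)
... | b , k≤|class| = b , descendingPrimes⇒monochromaticCoprime k k≤|class|
  (AllPairsₚ.filter⁺ _ (primesIn-descending m n))
  (Allₚ.filter⁺ _ (primesIn-bounds m n))
  (Allₚ.all-filter _ (primesIn m n))

∃-least : ∀ {P : ℕ → Set} → Decidable P → ∀ {n} → P n → ∃ (IsLeast P)
∃-least {P} P? {n} = <-rec (λ n → P n → ∃ (IsLeast P)) search n
  where
  search : ∀ n → (∀ {j} → j < n → P j → ∃ (IsLeast P)) → P n → ∃ (IsLeast P)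
  search n smaller Pn with anyUpTo? P? n
  ... | yes (j , j<n , Pj) = smaller j<n Pj
  ... | no ∄j = n , Pn , λ j Pj → ≮⇒≥ (λ j<n → ∄j (j , j<n , Pj))

∃-listOfLength? : ∀ B {Q : List ℕ → Set} → Decidable Q → (∀ {xs} → Q xs → All (_< B) xs) →
  ∀ k → Dec (∃ λ xs → length xs ≡ k × Q xs)
∃-listOfLength? B {Q} Q? bounded zero = Dec.map′ (λ Q[] → [] , refl , Q[]) nil (Q? [])
  where
  nil : (∃ λ xs → length xs ≡ 0 × Q xs) → Q []
  nil ([] , _ , Q[]) = Q[]
∃-listOfLength? B {Q} Q? bounded (suc k) =
  Dec.map′ cons uncons (anyUpTo? (λ x → ∃-listOfLength? B (Q? ∘ (x ∷_)) (All.tail ∘ bounded) k) B)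
  where
  cons : (∃ λ x → x < B × ∃ λ xs → length xs ≡ k × Q (x ∷ xs)) → ∃ λ xs → length xs ≡ suc k × Q xs
  cons (x , _ , xs , refl , Qx∷xs) = x ∷ xs , refl , Qx∷xs
  uncons : (∃ λ xs → length xs ≡ suc k × Q xs) → ∃ λ x → x < B × ∃ λ xs → length xs ≡ k × Q (x ∷ xs)
  uncons (x ∷ xs , refl , Qx∷xs) = x , All.head (bounded Qx∷xs) , xs , refl , Qx∷xs

∃-Bool? : ∀ {P : Bool → Set} → Decidable P → Dec (∃ P)
∃-Bool? P? = Dec.map′ [ true ,_ , false ,_ ] (λ { (true , Pt) → inj₁ Pt ; (false , Pf) → inj₂ Pf })
  (P? true ⊎-dec P? false)

AgreeBelow : ℕ → (ℕ → Bool) → (ℕ → Bool) → Set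
AgreeBelow B c c′ = ∀ x → x < B → c x ≡ c′ x

recolor : (ℕ → Bool) → ℕ → Bool → ℕ → Bool
recolor c y b x with x ≟ y
... | yes _ = b
... | no  _ = c x

recolor-self : ∀ c y x → recolor c y (c y) x ≡ c x
recolor-self c y x with x ≟ y
... | yes refl = refl
... | no  _    = refl

recolor-agree : ∀ {B c c′} b → AgreeBelow B c c′ → AgreeBelow (suc B) (recolor c B b) (recolor c′ B b)
recolor-agree {B} b agree x (s≤s x≤B) with x ≟ B
... | yes _   = refl
... | no  x≢B = agree x (≤∧≢⇒< x≤B x≢B)

all-colorings? : ∀ B {Q : (ℕ → Bool) → Set} → Decidable Q →
  (∀ {c c′} → AgreeBelow B c c′ → Q c → Q c′) → Dec (∀ c → Q c)
all-colorings? zero {Q} Q? respects =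
  Dec.map′ (λ Q[false] c → respects (λ _ ()) Q[false]) (λ ∀Q → ∀Q _) (Q? (λ _ → false))
all-colorings? (suc B) {Q} Q? respects = Dec.map′ split unsplit (forced true ×-dec forced false)
  where
  forced : ∀ b → Dec (∀ c → Q (recolor c B b))
  forced b = all-colorings? B (Q? ∘ λ c → recolor c B b) (respects ∘ recolor-agree b)
  split : (∀ c → Q (recolor c B true)) × (∀ c → Q (recolor c B false)) → ∀ c → Q c
  split (Qtrue , Qfalse) c = respects (λ x _ → recolor-self c B x) (Q-at (c B))
    where
    Q-at : ∀ b → Q (recolor c B b)
    Q-at true  = Qtrue c
    Q-at false = Qfalse c
  unsplit : (∀ c → Q c) → (∀ c → Q (recolor c B true)) × (∀ c → Q (recolor c B false))
  unsplit ∀Q = (λ c → ∀Q (recolor c B true)) , (λ c → ∀Q (recolor c B false))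

monochromaticCoprime? : ∀ m k n c b → Dec (MonochromaticCoprime m k n c b)
monochromaticCoprime? m k n c b = ∃-listOfLength? (suc (m + n))
  (λ xs → unique? xs ×-dec allPairs? coprime? xs ×-dec
          All.all? (λ x → suc m ≤? x ×-dec x ≤? m + n ×-dec c x Bool.≟ b) xs)
  (λ (_ , _ , inRange) → All.map (λ (_ , x≤m+n , _) → s≤s x≤m+n) inRange)
  k

copRamseyProperty? : ∀ m k n → Dec (CopRamseyProperty m k n)
copRamseyProperty? m k n =
  all-colorings? (suc (m + n)) (λ c → ∃-Bool? (monochromaticCoprime? m k n c)) respects
  where
  respects : ∀ {c c′} → AgreeBelow (suc (m + n)) c c′ →
    ∃ (MonochromaticCoprime m k n c) → ∃ (MonochromaticCoprime m k n c′)
  respects agree (b , xs , |xs|≡k , unique , coprime , inRange) =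
    b , xs , |xs|≡k , unique , coprime ,
    All.map (λ (lo , hi , cx≡b) → lo , hi , trans (sym (agree _ (s≤s hi))) cx≡b) inRange

∃-copRamseyNumber≤ : ∀ m k n → 1 ≤ n → CopRamseyProperty m k n →
  ∃ λ R → IsCopRamseyNumber m k R × R ≤ n
∃-copRamseyNumber≤ m k n 1≤n ramsey
  with ∃-least (λ n → 1 ≤? n ×-dec copRamseyProperty? m k n) (1≤n , ramsey)
... | R , R-least = R , R-least , proj₂ R-least n (1≤n , ramsey)

1≤2k∸1 : ∀ {k} → 1 ≤ k → 1 ≤ 2 * k ∸ 1
1≤2k∸1 1≤k = ∸-monoˡ-≤ 1 (*-monoʳ-≤ 2 1≤k)

proposition7p2 : (m k : ℕ) → 2 ≤ k →
    ∃ λ (R : ℕ) → ∃ λ (N : ℕ) →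
      IsCopRamseyNumber m k R ×
      IsLeast (λ n → 2 * k ∸ 1 ≤ primeCount (m + n) ∸ primeCount m) N ×
      R ≤ N ×
      (∀ p → IsNthPrime (primeCount m + (2 * k ∸ 1)) p → N ≤ p ∸ m)
proposition7p2 m k 2≤k
  with ∃-least (λ n → 2 * k ∸ 1 ≤? primeCount (m + n) ∸ primeCount m)
               (proj₂ (atLeastPrimesIn-unbounded (2 * k ∸ 1) m))
... | N , N-least
  with ∃-copRamseyNumber≤ m k N
         (atLeastPrimesIn-positive m (1≤2k∸1 (<⇒≤ 2≤k)) (proj₁ N-least))
         (primes⇒copRamsey m k N (proj₁ N-least))
... | R , R-isRamsey , R≤N =
  R , N , R-isRamsey , N-least , R≤N ,
  λ p p-nth → proj₂ N-least (p ∸ m) (nthPrime⇒atLeastPrimesIn m p-nth)
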